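{- Let $\mathbf A=(A;\cdot,\rightarrow,1)$ and $\mathbf B=(B;\cdot,\rightarrow,1)$ be hoops and let $f\colon B\to A$ be a product morphism. Then the $f$-product $\mathbf A\ltimes_f\mathbf B$ is a hoop.
   Context: A hoop is an algebra $\mathbf A=(A;\cdot,\rightarrow,1)$ of type $\langle 2,2,0\rangle$ such that $(A;\cdot,1)$ is a commutative monoid and the identities $x\rightarrow x=1$, $(x\cdot y)\rightarrow z=x\rightarrow(y\rightarrow z)$ and $x\cdot(x\rightarrow y)=y\cdot(y\rightarrow x)$ hold. The order is $x\leq y$ iff $x\rightarrow y=1$; infima exist and $x\wedge y=x\cdot(x\rightarrow y)$. A map $f\colon B\to A$ between hoops is a product morphism if $f(1)=1$ and $f(x)\cdot f(y)=f(x\cdot y)=f(x)\wedge f(y)=f(x\wedge y)$ for all $x,y\in B$. For such $f$, the $f$-product $\mathbf A\ltimes_f\mathbf B$ is the algebra whose universe is $\{(a,x)\in A\times B\mid a\leq f(x)\}$, with constant $(1,1)$ and operations $(a,x)\cdot(b,y)=(a\cdot b,\,x\cdot y)$ and $(a,x)\rightarrow(b,y)=(f(x\rightarrow y)\wedge(a\rightarrow b),\,x\rightarrow y)$. -}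

module Defs where

open import Level using (Level; _⊔_; suc)
open import Data.Product using (Σ; Σ-syntax; _×_; _,_; proj₁; proj₂)
open import Relation.Binary.Core using (Rel)
open import Relation.Binary.PropositionalEquality using (_≡_)
open import Algebra.Core using (Op₂)
open import Algebra.Structures using (IsCommutativeMonoid)
open import Algebra.Definitions using (Congruent₂)

record IsHoop {a ℓ} {A : Set a} (_≈_ : Rel A ℓ)
              (_·_ : Op₂ A) (_⇒_ : Op₂ A) (1# : A) : Set (a ⊔ ℓ) where
  field
    isCommutativeMonoid : IsCommutativeMonoid _≈_ _·_ 1#
    ⇒-cong   : Congruent₂ _≈_ _⇒_
    ⇒-refl   : ∀ x → (x ⇒ x) ≈ 1#
    ⇒-curry  : ∀ x y z → ((x · y) ⇒ z) ≈ (x ⇒ (y ⇒ z))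
    divisib  : ∀ x y → (x · (x ⇒ y)) ≈ (y · (y ⇒ x))

record Hoop a ℓ : Set (suc (a ⊔ ℓ)) where
  infixl 7 _·_
  infixr 5 _⇒_
  infix 4 _≈_ _≤_
  field
    Carrier : Set a
    _≈_     : Rel Carrier ℓ
    _·_     : Op₂ Carrier
    _⇒_     : Op₂ Carrier
    1#      : Carrier
    isHoop  : IsHoop _≈_ _·_ _⇒_ 1#
  open IsHoop isHoop public

  _≤_ : Carrier → Carrier → Set ℓ
  x ≤ y = (x ⇒ y) ≈ 1#

  _∧_ : Op₂ Carrier
  x ∧ y = x · (x ⇒ y)

module _ {a b ℓ₁ ℓ₂} (𝐀 : Hoop a ℓ₁) (𝐁 : Hoop b ℓ₂) where
  private
    module A = Hoop 𝐀
    module B = Hoop 𝐁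

  record IsProductMorphism (f : B.Carrier → A.Carrier) : Set (b ⊔ ℓ₁ ⊔ ℓ₂) where
    field
      f-cong : ∀ {x y} → x B.≈ y → f x A.≈ f y
      f-1    : f B.1# A.≈ A.1#
      f-·    : ∀ x y → (f x A.· f y) A.≈ f (x B.· y)
      f-·∧   : ∀ x y → f (x B.· y) A.≈ (f x A.∧ f y)
      f-∧    : ∀ x y → (f x A.∧ f y) A.≈ f (x B.∧ y)

  ProdCarrier : (f : B.Carrier → A.Carrier) → Set (a ⊔ b ⊔ ℓ₁)
  ProdCarrier f = Σ[ p ∈ A.Carrier × B.Carrier ] (proj₁ p A.≤ f (proj₂ p))

  _≈ₚ_ : {f : B.Carrier → A.Carrier} → Rel (ProdCarrier f) (ℓ₁ ⊔ ℓ₂)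
  ((a , x) , _) ≈ₚ ((c , y) , _) = (a A.≈ c) × (x B.≈ y)

  prodMul : A.Carrier × B.Carrier → A.Carrier × B.Carrier → A.Carrier × B.Carrier
  prodMul (a , x) (c , y) = (a A.· c , x B.· y)

  prodImp : (f : B.Carrier → A.Carrier) →
            A.Carrier × B.Carrier → A.Carrier × B.Carrier → A.Carrier × B.Carrier
  prodImp f (a , x) (c , y) = (f (x B.⇒ y) A.∧ (a A.⇒ c) , x B.⇒ y)

  -- "the f-product A ⋉_f B is a hoop": the operations defined by the above
  -- formulas (together with the constant (1,1)) are well defined on the
  -- universe ProdCarrier f and form a hoop there.
  FProductIsHoop : (f : B.Carrier → A.Carrier) → Set (a ⊔ b ⊔ ℓ₁ ⊔ ℓ₂)
  FProductIsHoop f =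
    Σ[ _·ₚ_ ∈ Op₂ (ProdCarrier f) ]
    Σ[ _⇒ₚ_ ∈ Op₂ (ProdCarrier f) ]
    Σ[ 1ₚ ∈ ProdCarrier f ]
      ((∀ p q → proj₁ (p ·ₚ q) ≡ prodMul (proj₁ p) (proj₁ q))
     × (∀ p q → proj₁ (p ⇒ₚ q) ≡ prodImp f (proj₁ p) (proj₁ q))
     × (proj₁ 1ₚ ≡ (A.1# , B.1#))
     × IsHoop _≈ₚ_ _·ₚ_ _⇒ₚ_ 1ₚ)

-- The f-product is a subalgebra of A × B for the monoid part, so only the
-- residuation laws need work, and both reduce to facts about the first
-- component. For curry, the extra meet with f (y ⇒ z) in the first component
-- of (a , x) ⇒ₚ ((c , y) ⇒ₚ (d , z)) is harmless because f (x ⇒ (y ⇒ z)) · a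
-- already lies below it. For divisibility, a · (f (x ⇒ y) ∧ (a ⇒ c)) collapses
-- to the symmetric a ∧ c because f (x ⇒ y) is an idempotent above c, and
-- an idempotent acts as the identity on the elements below it.
module Submission where

open import Defs
open import Function.Base using (id)
open import Level using (_⊔_)
open import Data.Product using (_,_; proj₁)
open import Algebra.Bundles using (CommutativeMonoid)
open import Algebra.Core using (Op₂)
open import Algebra.Definitions using (Congruent₂)
open import Algebra.Structures using (IsCommutativeMonoid)
open import Algebra.Morphism.Structures using (IsMonoidMonomorphism)
open import Relation.Binary.Core using (Rel)
open import Relation.Binary.Bundles using (Poset)
open import Relation.Binary.Lattice.Bundles using (MeetSemilattice)
open import Relation.Binary.PropositionalEquality using () renaming (refl to ≡-refl)
import Algebra.Construct.DirectProduct as DirectProduct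
import Algebra.Morphism.MonoidMonomorphism as MonoidMonomorphism
import Relation.Binary.Lattice.Properties.MeetSemilattice as MeetSemilatticeProperties
import Relation.Binary.Reasoning.Setoid as ≈-Reasoning
import Relation.Binary.Reasoning.PartialOrder as ≤-Reasoning

module HoopProperties {a ℓ} (𝐇 : Hoop a ℓ) where

  open Hoop 𝐇 public
  open IsCommutativeMonoid isCommutativeMonoid public
    using (setoid; refl; sym; trans; assoc; comm; identityˡ; identityʳ)
    renaming (∙-cong to ·-cong; ∙-congˡ to ·-congˡ; ∙-congʳ to ·-congʳ)

  commutativeMonoid : CommutativeMonoid a ℓ
  commutativeMonoid = record { isCommutativeMonoid = isCommutativeMonoid }

  ⇒-congˡ : ∀ {x y z} → y ≈ z → x ⇒ y ≈ x ⇒ z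
  ⇒-congˡ = ⇒-cong refl

  ⇒-congʳ : ∀ {x y z} → x ≈ y → x ⇒ z ≈ y ⇒ z
  ⇒-congʳ e = ⇒-cong e refl

  curry-≤ : ∀ {x y z} → x · y ≤ z → x ≤ y ⇒ z
  curry-≤ {x} {y} {z} = trans (sym (⇒-curry x y z))

  uncurry-≤ : ∀ {x y z} → x ≤ y ⇒ z → x · y ≤ z
  uncurry-≤ {x} {y} {z} = trans (⇒-curry x y z)

  ≈⇒≤ : ∀ {x y} → x ≈ y → x ≤ y
  ≈⇒≤ {x} e = trans (⇒-congˡ (sym e)) (⇒-refl x)

  x≤y⇒x∧y≈x : ∀ {x y} → x ≤ y → x ∧ y ≈ x
  x≤y⇒x∧y≈x {x} x≤y = trans (·-congˡ x≤y) (identityʳ x)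

  ≤-antisym : ∀ {x y} → x ≤ y → y ≤ x → x ≈ y
  ≤-antisym {x} {y} x≤y y≤x = begin
    x     ≈⟨ x≤y⇒x∧y≈x x≤y ⟨
    x ∧ y ≈⟨ divisib x y ⟩
    y ∧ x ≈⟨ x≤y⇒x∧y≈x y≤x ⟩
    y     ∎
    where open ≈-Reasoning setoid

  x≈x·[x⇒1] : ∀ x → x ≈ x · (x ⇒ 1#)
  x≈x·[x⇒1] x = begin
    x                                ≈⟨ identityʳ x ⟨
    x · 1#                           ≈⟨ ·-congˡ x⇒[1⇒x]≈1 ⟨
    x · (x ⇒ (1# ⇒ x))               ≈⟨ divisib x (1# ⇒ x) ⟩
    (1# ⇒ x) · ((1# ⇒ x) ⇒ x)        ≈⟨ ·-cong 1⇒x≈x·u (⇒-congʳ 1⇒x≈x·u) ⟩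
    (x · u) · ((x · u) ⇒ x)          ≈⟨ ·-congˡ [x·u]⇒x≈u⇒1 ⟩
    (x · u) · (u ⇒ 1#)               ≈⟨ assoc x u (u ⇒ 1#) ⟩
    x · (u · (u ⇒ 1#))               ≈⟨ ·-congˡ u·[u⇒1]≈u ⟩
    x · u                            ∎
    where
    open ≈-Reasoning setoid
    u = x ⇒ 1#
    x⇒[1⇒x]≈1 : x ⇒ (1# ⇒ x) ≈ 1#
    x⇒[1⇒x]≈1 = trans (sym (⇒-curry x 1# x)) (trans (⇒-congʳ (identityʳ x)) (⇒-refl x))
    1⇒x≈x·u : 1# ⇒ x ≈ x · u
    1⇒x≈x·u = sym (trans (divisib x 1#) (identityˡ (1# ⇒ x)))
    [x·u]⇒x≈u⇒1 : (x · u) ⇒ x ≈ u ⇒ 1#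
    [x·u]⇒x≈u⇒1 = trans (⇒-congʳ (comm x u)) (trans (⇒-curry u x x) (⇒-congˡ (⇒-refl x)))
    u·[u⇒1]≈u : u · (u ⇒ 1#) ≈ u
    u·[u⇒1]≈u = begin
      u · (u ⇒ 1#)   ≈⟨ divisib u 1# ⟩
      1# · (1# ⇒ u)  ≈⟨ identityˡ (1# ⇒ u) ⟩
      1# ⇒ (x ⇒ 1#)  ≈⟨ ⇒-curry 1# x 1# ⟨
      (1# · x) ⇒ 1#  ≈⟨ ⇒-congʳ (identityˡ x) ⟩
      u              ∎

  x⇒1≈1 : ∀ x → x ⇒ 1# ≈ 1#
  x⇒1≈1 x = begin
    x ⇒ 1#                 ≈⟨ ⇒-congʳ (x≈x·[x⇒1] x) ⟩
    (x · (x ⇒ 1#)) ⇒ 1#    ≈⟨ ⇒-congʳ (comm x (x ⇒ 1#)) ⟩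
    ((x ⇒ 1#) · x) ⇒ 1#    ≈⟨ ⇒-curry (x ⇒ 1#) x 1# ⟩
    (x ⇒ 1#) ⇒ (x ⇒ 1#)    ≈⟨ ⇒-refl (x ⇒ 1#) ⟩
    1#                     ∎
    where open ≈-Reasoning setoid

  ≤-trans : ∀ {x y z} → x ≤ y → y ≤ z → x ≤ z
  ≤-trans {x} {y} {z} x≤y y≤z = begin
    x ⇒ z                    ≈⟨ ⇒-congʳ x≈y∧x ⟩
    (y · (y ⇒ x)) ⇒ z        ≈⟨ ⇒-congʳ (comm y (y ⇒ x)) ⟩
    ((y ⇒ x) · y) ⇒ z        ≈⟨ ⇒-curry (y ⇒ x) y z ⟩
    (y ⇒ x) ⇒ (y ⇒ z)        ≈⟨ ⇒-congˡ y≤z ⟩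
    (y ⇒ x) ⇒ 1#             ≈⟨ x⇒1≈1 (y ⇒ x) ⟩
    1#                       ∎
    where
    open ≈-Reasoning setoid
    x≈y∧x : x ≈ y ∧ x
    x≈y∧x = trans (sym (x≤y⇒x∧y≈x x≤y)) (divisib x y)

  poset : Poset a ℓ ℓ
  poset = record
    { isPartialOrder = record
      { isPreorder = record
        { isEquivalence = IsCommutativeMonoid.isEquivalence isCommutativeMonoid
        ; reflexive     = ≈⇒≤
        ; trans         = ≤-trans
        }
      ; antisym = ≤-antisym
      }
    }

  open Poset poset public using () renaming (refl to ≤-refl)
  open ≤-Reasoning poset

  x·y≤y : ∀ x y → x · y ≤ y
  x·y≤y x y = begin-equality
    (x · y) ⇒ y   ≈⟨ ⇒-curry x y y ⟩
    x ⇒ (y ⇒ y)   ≈⟨ ⇒-congˡ (⇒-refl y) ⟩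
    x ⇒ 1#        ≈⟨ x⇒1≈1 x ⟩
    1#            ∎

  x·y≤x : ∀ x y → x · y ≤ x
  x·y≤x x y = ≤-trans (≈⇒≤ (comm x y)) (x·y≤y y x)

  [x⇒y]·x≤y : ∀ x y → (x ⇒ y) · x ≤ y
  [x⇒y]·x≤y x y = uncurry-≤ ≤-refl

  y≤x⇒y : ∀ x y → y ≤ x ⇒ y
  y≤x⇒y x y = curry-≤ (x·y≤x y x)

  ·-monoˡ-≤ : ∀ {x y} z → x ≤ y → x · z ≤ y · z
  ·-monoˡ-≤ {x} {y} z x≤y = uncurry-≤ (≤-trans x≤y (curry-≤ ≤-refl))

  ·-monoʳ-≤ : ∀ {x y} z → x ≤ y → z · x ≤ z · y
  ·-monoʳ-≤ {x} {y} z x≤y = begin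
    z · x ≈⟨ comm z x ⟩
    x · z ≤⟨ ·-monoˡ-≤ z x≤y ⟩
    y · z ≈⟨ comm y z ⟩
    z · y ∎

  ·-mono-≤ : ∀ {x y u v} → x ≤ y → u ≤ v → x · u ≤ y · v
  ·-mono-≤ {y = y} {u} x≤y u≤v = ≤-trans (·-monoˡ-≤ u x≤y) (·-monoʳ-≤ y u≤v)

  ⇒-monoʳ-≤ : ∀ x {y z} → y ≤ z → x ⇒ y ≤ x ⇒ z
  ⇒-monoʳ-≤ x {y} y≤z = curry-≤ (≤-trans ([x⇒y]·x≤y x y) y≤z)

  x∧y≤x : ∀ x y → x ∧ y ≤ x
  x∧y≤x x y = x·y≤x x (x ⇒ y)

  x∧y≤y : ∀ x y → x ∧ y ≤ y
  x∧y≤y x y = ≤-trans (≈⇒≤ (divisib x y)) (x∧y≤x y x)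

  ∧-greatest : ∀ {x y z} → z ≤ x → z ≤ y → z ≤ x ∧ y
  ∧-greatest {x} {y} {z} z≤x z≤y = begin
    z       ≈⟨ x≤y⇒x∧y≈x z≤x ⟨
    z ∧ x   ≈⟨ divisib z x ⟩
    x ∧ z   ≤⟨ ·-monoʳ-≤ x (⇒-monoʳ-≤ x z≤y) ⟩
    x ∧ y   ∎

  meetSemilattice : MeetSemilattice a ℓ ℓ
  meetSemilattice = record
    { isMeetSemilattice = record
      { isPartialOrder = Poset.isPartialOrder poset
      ; infimum        = λ x y → x∧y≤x x y , x∧y≤y x y , λ z → ∧-greatest
      }
    }

  open MeetSemilatticeProperties meetSemilattice public
    using (∧-cong; ∧-idempotent; ∧-monotonic; y≤x⇒x∧y≈y)

  x·y≤x∧y : ∀ x y → x · y ≤ x ∧ y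
  x·y≤x∧y x y = ∧-greatest (x·y≤x x y) (x·y≤y x y)

  idempotent⇒e∧x≤e·x : ∀ {e} x → e · e ≈ e → e ∧ x ≤ e · x
  idempotent⇒e∧x≤e·x {e} x e·e≈e = begin
    e · (e ⇒ x)        ≈⟨ ·-congʳ e·e≈e ⟨
    (e · e) · (e ⇒ x)  ≈⟨ assoc e e (e ⇒ x) ⟩
    e · (e ∧ x)        ≤⟨ ·-monoʳ-≤ e (x∧y≤y e x) ⟩
    e · x              ∎

  x∧[y⇒z]≈x∧[y⇒e∧z] : ∀ {x y z e} → x · y ≤ e → x ∧ (y ⇒ z) ≈ x ∧ (y ⇒ (e ∧ z))
  x∧[y⇒z]≈x∧[y⇒e∧z] {x} {y} {z} {e} x·y≤e = ≤-antisym
    (∧-greatest (x∧y≤x x (y ⇒ z)) (curry-≤ (∧-greatest below-e below-z)))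
    (∧-monotonic ≤-refl (⇒-monoʳ-≤ y (x∧y≤y e z)))
    where
    below-e : (x ∧ (y ⇒ z)) · y ≤ e
    below-e = ≤-trans (·-monoˡ-≤ y (x∧y≤x x (y ⇒ z))) x·y≤e
    below-z : (x ∧ (y ⇒ z)) · y ≤ z
    below-z = ≤-trans (·-monoˡ-≤ y (x∧y≤y x (y ⇒ z))) ([x⇒y]·x≤y y z)

  x·[e∧[x⇒y]]≈x∧y : ∀ {x y e} → e · e ≈ e → y ≤ e → x · (e ∧ (x ⇒ y)) ≈ x ∧ y
  x·[e∧[x⇒y]]≈x∧y {x} {y} {e} e·e≈e y≤e = ≤-antisym
    (·-monoʳ-≤ x (x∧y≤y e (x ⇒ y)))
    (begin
      x ∧ y              ≈⟨ y≤x⇒x∧y≈y (≤-trans (x∧y≤y x y) y≤e) ⟨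
      e ∧ (x ∧ y)        ≤⟨ idempotent⇒e∧x≤e·x (x ∧ y) e·e≈e ⟩
      e · (x · (x ⇒ y))  ≈⟨ assoc e x (x ⇒ y) ⟨
      (e · x) · (x ⇒ y)  ≈⟨ ·-congʳ (comm e x) ⟩
      (x · e) · (x ⇒ y)  ≈⟨ assoc x e (x ⇒ y) ⟩
      x · (e · (x ⇒ y))  ≤⟨ ·-monoʳ-≤ x (x·y≤x∧y e (x ⇒ y)) ⟩
      x · (e ∧ (x ⇒ y))  ∎)

module ProductMorphismProperties {a b ℓ₁ ℓ₂} (𝐀 : Hoop a ℓ₁) (𝐁 : Hoop b ℓ₂)
  {f : Hoop.Carrier 𝐁 → Hoop.Carrier 𝐀} (isProductMorphism : IsProductMorphism 𝐀 𝐁 f) where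

  module A = HoopProperties 𝐀
  module B = HoopProperties 𝐁
  open IsProductMorphism isProductMorphism public

  f-mono : ∀ {x y} → x B.≤ y → f x A.≤ f y
  f-mono {x} {y} x≤y =
    A.≤-trans (A.≈⇒≤ (A.trans (f-cong (B.sym (B.x≤y⇒x∧y≈x x≤y))) (A.sym (f-∧ x y))))
              (A.x∧y≤y (f x) (f y))

  f-idempotent : ∀ x → f x A.· f x A.≈ f x
  f-idempotent x = A.trans (f-· x x) (A.trans (f-·∧ x x) (A.∧-idempotent (f x)))

  f-·-≤ : ∀ {a c x y} → a A.≤ f x → c A.≤ f y → a A.· c A.≤ f (x B.· y)
  f-·-≤ {x = x} {y} a≤fx c≤fy = A.≤-trans (A.·-mono-≤ a≤fx c≤fy) (A.≈⇒≤ (f-· x y))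

  f[x⇒y]·fx≤fy : ∀ x y → f (x B.⇒ y) A.· f x A.≤ f y
  f[x⇒y]·fx≤fy x y = A.≤-trans (A.≈⇒≤ (f-· (x B.⇒ y) x)) (f-mono (B.[x⇒y]·x≤y x y))

module FProduct {a b ℓ₁ ℓ₂} (𝐀 : Hoop a ℓ₁) (𝐁 : Hoop b ℓ₂)
  {f : Hoop.Carrier 𝐁 → Hoop.Carrier 𝐀} (isProductMorphism : IsProductMorphism 𝐀 𝐁 f) where

  open ProductMorphismProperties 𝐀 𝐁 isProductMorphism

  Carrier : Set (a ⊔ b ⊔ ℓ₁)
  Carrier = ProdCarrier 𝐀 𝐁 f

  infix 4 _≈ₚ′_
  _≈ₚ′_ : Rel Carrier (ℓ₁ ⊔ ℓ₂)
  _≈ₚ′_ = _≈ₚ_ 𝐀 𝐁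

  infixl 7 _·ₚ_
  _·ₚ_ : Op₂ Carrier
  (u , a≤fx) ·ₚ (v , c≤fy) = prodMul 𝐀 𝐁 u v , f-·-≤ a≤fx c≤fy

  infixr 5 _⇒ₚ_
  _⇒ₚ_ : Op₂ Carrier
  (u , _) ⇒ₚ (v , _) = prodImp 𝐀 𝐁 f u v , A.x∧y≤x _ _

  1ₚ : Carrier
  1ₚ = (A.1# , B.1#) , A.≈⇒≤ (A.sym f-1)

  proj₁-isMonoidMonomorphism :
    IsMonoidMonomorphism
      (record { _≈_ = _≈ₚ′_ ; _∙_ = _·ₚ_ ; ε = 1ₚ })
      (DirectProduct.rawMonoid (CommutativeMonoid.rawMonoid A.commutativeMonoid)
                               (CommutativeMonoid.rawMonoid B.commutativeMonoid))
      proj₁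
  proj₁-isMonoidMonomorphism = record
    { isMonoidHomomorphism = record
      { isMagmaHomomorphism = record
        { isRelHomomorphism = record { cong = id }
        ; homo              = λ _ _ → A.refl , B.refl
        }
      ; ε-homo = A.refl , B.refl
      }
    ; injective = id
    }

  ·ₚ-isCommutativeMonoid : IsCommutativeMonoid _≈ₚ′_ _·ₚ_ 1ₚ
  ·ₚ-isCommutativeMonoid =
    MonoidMonomorphism.isCommutativeMonoid proj₁-isMonoidMonomorphism
      (CommutativeMonoid.isCommutativeMonoid
        (DirectProduct.commutativeMonoid A.commutativeMonoid B.commutativeMonoid))

  ⇒ₚ-cong : Congruent₂ _≈ₚ′_ _⇒ₚ_
  ⇒ₚ-cong (a≈a′ , x≈x′) (c≈c′ , y≈y′) =
    A.∧-cong (f-cong x⇒y≈x′⇒y′) (A.⇒-cong a≈a′ c≈c′) , x⇒y≈x′⇒y′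
    where x⇒y≈x′⇒y′ = B.⇒-cong x≈x′ y≈y′

  ⇒ₚ-refl : ∀ p → p ⇒ₚ p ≈ₚ′ 1ₚ
  ⇒ₚ-refl ((a , x) , _) =
    A.trans (A.∧-cong (A.trans (f-cong (B.⇒-refl x)) f-1) (A.⇒-refl a)) (A.∧-idempotent A.1#)
    , B.⇒-refl x

  ⇒ₚ-curry : ∀ p q r → (p ·ₚ q) ⇒ₚ r ≈ₚ′ p ⇒ₚ (q ⇒ₚ r)
  ⇒ₚ-curry ((a , x) , a≤fx) ((c , y) , _) ((d , z) , _) =
    A.trans (A.∧-cong (f-cong (B.⇒-curry x y z)) (A.⇒-curry a c d))
            (A.x∧[y⇒z]≈x∧[y⇒e∧z] f[x⇒[y⇒z]]·a≤f[y⇒z])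
    , B.⇒-curry x y z
    where
    f[x⇒[y⇒z]]·a≤f[y⇒z] : f (x B.⇒ (y B.⇒ z)) A.· a A.≤ f (y B.⇒ z)
    f[x⇒[y⇒z]]·a≤f[y⇒z] =
      A.≤-trans (A.·-monoʳ-≤ _ a≤fx) (f[x⇒y]·fx≤fy x (y B.⇒ z))

  ⇒ₚ-divisib : ∀ p q → p ·ₚ (p ⇒ₚ q) ≈ₚ′ q ·ₚ (q ⇒ₚ p)
  ⇒ₚ-divisib ((a , x) , a≤fx) ((c , y) , c≤fy) =
    A.trans (·f⇒∧⇒≈∧ a≤fx c≤fy) (A.trans (A.divisib a c) (A.sym (·f⇒∧⇒≈∧ c≤fy a≤fx)))
    , B.divisib x y
    where
    ·f⇒∧⇒≈∧ : ∀ {a c x y} → a A.≤ f x → c A.≤ f y →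
              a A.· (f (x B.⇒ y) A.∧ (a A.⇒ c)) A.≈ a A.∧ c
    ·f⇒∧⇒≈∧ {x = x} {y} _ c≤fy =
      A.x·[e∧[x⇒y]]≈x∧y (f-idempotent (x B.⇒ y)) (A.≤-trans c≤fy (f-mono (B.y≤x⇒y x y)))

  isHoop : IsHoop _≈ₚ′_ _·ₚ_ _⇒ₚ_ 1ₚ
  isHoop = record
    { isCommutativeMonoid = ·ₚ-isCommutativeMonoid
    ; ⇒-cong              = λ {p} {p′} {q} {q′} → ⇒ₚ-cong {p} {p′} {q} {q′}
    ; ⇒-refl              = ⇒ₚ-refl
    ; ⇒-curry             = ⇒ₚ-curry
    ; divisib             = ⇒ₚ-divisib
    }

theorem8 : ∀ {a b ℓ₁ ℓ₂} (𝐀 : Hoop a ℓ₁) (𝐁 : Hoop b ℓ₂)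
           (f : Hoop.Carrier 𝐁 → Hoop.Carrier 𝐀) →
           IsProductMorphism 𝐀 𝐁 f → FProductIsHoop 𝐀 𝐁 f
theorem8 𝐀 𝐁 f isProductMorphism =
  _·ₚ_ , _⇒ₚ_ , 1ₚ , (λ _ _ → ≡-refl) , (λ _ _ → ≡-refl) , ≡-refl , isHoop
  where open FProduct 𝐀 𝐁 isProductMorphism
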